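{- Let $\mathbf{f}$ be the infinite Fibonacci word and, for $i\geq 1$, let $\mathbf{f}^{[i]}$ be the $i$-Fibonacci word (definitions in the context). For each integer $i\geq 0$ let $\varphi_i:\{0,1\}^*\to\{0,1\}^*$ be the morphism with $\varphi_i(0)=0$ and $\varphi_i(1)=0^i1$ (extended letterwise to infinite words). Then $\mathbf{f}^{[i+2]}=\varphi_i(\mathbf{f})$ for all $i\geq 0$.
   Context: The finite Fibonacci words are $f_0=1$, $f_1=0$, $f_n=f_{n-1}f_{n-2}$ ($n\geq 2$, concatenation), and the infinite Fibonacci word is $\mathbf{f}=\lim_{n\to\infty}f_n=0100101001001\cdots$ (each $f_n$, $n\ge1$, is a prefix of $f_{n+1}$). For $i\geq 1$, the $(n,i)$-Fibonacci words are defined by $f^{[i]}_0=0$, $f^{[i]}_1=0^{i-1}1$, $f^{[i]}_n=f^{[i]}_{n-1}f^{[i]}_{n-2}$ for $n\geq 2$, and the $i$-Fibonacci word is $\mathbf{f}^{[i]}=\lim_{n\to\infty}f^{[i]}_n$. Here $0^k$ denotes $k$ copies of the letter $0$. -}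

module Defs where

open import Data.Nat using (ℕ; zero; suc; _≤_)
open import Data.List using (List; []; _∷_; _++_; replicate; concatMap)
open import Data.Maybe using (Maybe; just; nothing)
open import Data.Product using (∃)
open import Relation.Binary.PropositionalEquality using (_≡_)

data Bit : Set where
  b0 b1 : Bit

Word : Set
Word = List Bit

InfWord : Set
InfWord = ℕ → Bit

_!?_ : Word → ℕ → Maybe Bit
[] !? k = nothing
(x ∷ w) !? zero = just x
(x ∷ w) !? suc k = w !? k

prefix : ℕ → InfWord → Word
prefix zero w = []
prefix (suc n) w = w 0 ∷ prefix n (λ k → w (suc k))

IsLimit : (ℕ → Word) → InfWord → Set
IsLimit ws w = ∀ k → ∃ λ N → ∀ n → N ≤ n → ws n !? k ≡ just (w k)

fib : ℕ → Word
fib zero = b1 ∷ []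
fib (suc zero) = b0 ∷ []
fib (suc (suc n)) = fib (suc n) ++ fib n

-- (n,i)-Fibonacci words: f_0 = 0, f_1 = 0^{i-1} 1, f_n = f_{n-1} f_{n-2}
-- (used for i ≥ 1; ∸ is truncated subtraction)
fibI : ℕ → ℕ → Word
fibI i zero = b0 ∷ []
fibI i (suc zero) = replicate (i Data.Nat.∸ 1) b0 ++ (b1 ∷ [])
fibI i (suc (suc n)) = fibI i (suc n) ++ fibI i n

φ-letter : ℕ → Bit → Word
φ-letter i b0 = b0 ∷ []
φ-letter i b1 = replicate i b0 ++ (b1 ∷ [])

φ : ℕ → Word → Word
φ i = concatMap (φ-letter i)

-- φ_i applied to an infinite word w is the limit of φ_i applied to its prefixes
IsφImage : ℕ → InfWord → InfWord → Set
IsφImage i w v = IsLimit (λ n → φ i (prefix n w)) v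

module Submission where

-- The sequence n ↦ f_{n+1} is a chain of words, each a prefix
-- of the next (f_{n+2} = f_{n+1} f_n), whose lengths grow at least like n;
-- any such "growing chain" of finite words has a limit.  The morphism φ_i
-- is a monoid homomorphism that never shortens words, so it maps growing
-- chains to growing chains, and the limit of the image chain is exactly
-- the φ_i-image of the limit.  Finally, by induction on n,
--   f^{[i+2]}_n = φ_i(f_{n+1}),
-- since both sides satisfy the Fibonacci recursion and agree for n = 0, 1.
-- Hence 𝐟^{[i+2]} = lim φ_i(f_{n+1}) = φ_i(𝐟).

open import Defs
open import Data.Nat using (ℕ; zero; suc; _+_; _≤_; _<_; _≤′_; ≤′-reflexive; ≤′-step; z≤n; s≤s)
open import Data.Nat.Properties
  using (≤-trans; ≤-reflexive; m≤m+n; +-mono-≤; +-comm; n≤1+n; ≤⇒≤′; module ≤-Reasoning)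
open import Data.Product using (∃; _×_; _,_; Σ; proj₁; proj₂)
open import Data.List using ([]; _∷_; _++_; length)
open import Data.List.Properties using (length-++; ++-assoc; ++-identityʳ)
open import Data.Maybe using (just)
open import Relation.Binary.PropositionalEquality
  using (_≡_; refl; sym; trans; cong; cong₂; subst; module ≡-Reasoning)

_≼_ : Word → Word → Set
u ≼ v = Σ Word λ s → u ++ s ≡ v

≼-refl : ∀ u → u ≼ u
≼-refl u = [] , ++-identityʳ u

≼-trans : ∀ {u v w} → u ≼ v → v ≼ w → u ≼ w
≼-trans {u} (s , refl) (t , refl) = s ++ t , sym (++-assoc u s t)

!?-≼ : ∀ {u v} k → k < length u → u ≼ v → v !? k ≡ u !? k
!?-≼ {x ∷ u} zero    _       (s , refl) = refl
!?-≼ {x ∷ u} (suc k) (s≤s p) (s , refl) = !?-≼ {u} k p (s , refl)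

-- The k-th letter of a word, with the (arbitrary) default b0 out of range;
-- used to read off the letters of a limit.
letterAt : Word → ℕ → Bit
letterAt []      k       = b0
letterAt (x ∷ w) zero    = x
letterAt (x ∷ w) (suc k) = letterAt w k

letterAt-!? : ∀ u k → k < length u → u !? k ≡ just (letterAt u k)
letterAt-!? (x ∷ u) zero    _       = refl
letterAt-!? (x ∷ u) (suc k) (s≤s p) = letterAt-!? u k p

Growing : (ℕ → Word) → Set
Growing g = (∀ n → g n ≼ g (suc n)) × (∀ n → n < length (g n))

module Limit {g : ℕ → Word} (growing : Growing g) where
  private
    step : ∀ n → g n ≼ g (suc n)
    step = proj₁ growing

    long : ∀ n → n < length (g n)
    long = proj₂ growing

  lim : InfWord
  lim k = letterAt (g k) k

  chain-≼ : ∀ {k m} → k ≤′ m → g k ≼ g m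
  chain-≼ {k} (≤′-reflexive refl) = ≼-refl (g k)
  chain-≼ {k} (≤′-step {m} p)     = ≼-trans (chain-≼ p) (step m)

  lim-at : ∀ k m → k ≤ m → g m !? k ≡ just (lim k)
  lim-at k m p = trans (!?-≼ k (long k) (chain-≼ (≤⇒≤′ p))) (letterAt-!? (g k) k (long k))

  isLimit : IsLimit g lim
  isLimit k = k , lim-at k

IsLimit-unshift : ∀ {g w} → IsLimit (λ n → g (suc n)) w → IsLimit g w
IsLimit-unshift lim k with lim k
... | N , conv = suc N , λ { zero () ; (suc n) (s≤s p) → conv n p }

IsLimit-cong : ∀ {g h w} → (∀ n → g n ≡ h n) → IsLimit g w → IsLimit h w
IsLimit-cong g≡h lim k with lim k
... | N , conv = N , λ n p → subst (λ u → u !? k ≡ _) (g≡h n) (conv n p)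

prefix-length : ∀ n w → length (prefix n w) ≡ n
prefix-length zero    w = refl
prefix-length (suc n) w = cong suc (prefix-length n (λ k → w (suc k)))

prefix-≼ : ∀ n (w : InfWord) u → n ≤ length u →
           (∀ k → k < n → u !? k ≡ just (w k)) → prefix n w ≼ u
prefix-≼ zero    w u       _       _     = u , refl
prefix-≼ (suc n) w (x ∷ u) (s≤s p) agree with agree zero (s≤s z≤n)
... | refl with prefix-≼ n (λ k → w (suc k)) u p (λ k q → agree (suc k) (s≤s q))
...   | s , e = s , cong (x ∷_) e

φ-++ : ∀ i u v → φ i (u ++ v) ≡ φ i u ++ φ i v
φ-++ i []      v = refl
φ-++ i (x ∷ u) v = begin
    φ-letter i x ++ φ i (u ++ v)      ≡⟨ cong (φ-letter i x ++_) (φ-++ i u v) ⟩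
    φ-letter i x ++ (φ i u ++ φ i v)  ≡⟨ sym (++-assoc (φ-letter i x) (φ i u) (φ i v)) ⟩
    (φ-letter i x ++ φ i u) ++ φ i v  ∎
  where open ≡-Reasoning

φ-≼ : ∀ i {u v} → u ≼ v → φ i u ≼ φ i v
φ-≼ i {u} (s , refl) = φ i s , sym (φ-++ i u s)

φ-letter-nonempty : ∀ i b → 1 ≤ length (φ-letter i b)
φ-letter-nonempty i b0 = s≤s z≤n
φ-letter-nonempty zero    b1 = s≤s z≤n
φ-letter-nonempty (suc i) b1 = s≤s z≤n

φ-length : ∀ i u → length u ≤ length (φ i u)
φ-length i []      = z≤n
φ-length i (b ∷ u) = begin
  1 + length u                                ≤⟨ +-mono-≤ (φ-letter-nonempty i b) (φ-length i u) ⟩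
  length (φ-letter i b) + length (φ i u)      ≡⟨ sym (length-++ (φ-letter i b)) ⟩
  length (φ-letter i b ++ φ i u)              ∎
  where open ≤-Reasoning

φ-growing : ∀ i {g} → Growing g → Growing (λ n → φ i (g n))
φ-growing i {g} (step , long) =
  (λ n → φ-≼ i (step n)) , (λ n → ≤-trans (long n) (φ-length i (g n)))

-- The limit of the image of a growing chain is the φ_i-image of its limit:
-- φ_i(prefix n 𝐰) is a prefix of φ_i(g n) and is long enough.
φ-limit : ∀ i {g} (growing : Growing g) →
          IsφImage i (Limit.lim growing) (Limit.lim (φ-growing i growing))
φ-limit i {g} growing k = suc k , λ n k<n →
  let w        = Limit.lim growing
      pre≼g    = prefix-≼ n w (g n) (≤-trans (n≤1+n n) (proj₂ growing n))
                   (λ j j<n → Limit.lim-at growing j n (≤-trans (n≤1+n j) j<n))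
      k<|φpre| = ≤-trans k<n (≤-trans (≤-reflexive (sym (prefix-length n w)))
                                      (φ-length i (prefix n w)))
  in trans (sym (!?-≼ k k<|φpre| (φ-≼ i pre≼g)))
           (Limit.lim-at (φ-growing i growing) k n (≤-trans (n≤1+n k) k<n))

fib-nonempty : ∀ n → 1 ≤ length (fib n)
fib-nonempty zero          = s≤s z≤n
fib-nonempty (suc zero)    = s≤s z≤n
fib-nonempty (suc (suc n)) = begin
  1                                  ≤⟨ fib-nonempty (suc n) ⟩
  length (fib (suc n))               ≤⟨ m≤m+n _ _ ⟩
  length (fib (suc n)) + length (fib n) ≡⟨ sym (length-++ (fib (suc n))) ⟩
  length (fib (suc (suc n)))         ∎
  where open ≤-Reasoning

fib-long : ∀ n → n < length (fib (suc n))
fib-long zero    = s≤s z≤n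
fib-long (suc n) = begin
  2 + n                                   ≡⟨ +-comm 1 (suc n) ⟩
  suc n + 1                               ≤⟨ +-mono-≤ (fib-long n) (fib-nonempty n) ⟩
  length (fib (suc n)) + length (fib n)   ≡⟨ sym (length-++ (fib (suc n))) ⟩
  length (fib (suc (suc n)))              ∎
  where open ≤-Reasoning

fib-growing : Growing (λ n → fib (suc n))
fib-growing = (λ n → fib n , refl) , fib-long

-- f^{[i+2]}_n = φ_i(f_{n+1}): both obey the Fibonacci recursion
-- (using that φ_i is a homomorphism) and agree for n = 0, 1.
fibI-φ : ∀ i n → fibI (i + 2) n ≡ φ i (fib (suc n))
fibI-φ i zero = refl
fibI-φ i (suc zero) rewrite +-comm i 2 = cong (b0 ∷_) (sym (++-identityʳ _))
fibI-φ i (suc (suc n)) = begin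
  fibI (i + 2) (suc n) ++ fibI (i + 2) n          ≡⟨ cong₂ _++_ (fibI-φ i (suc n)) (fibI-φ i n) ⟩
  φ i (fib (suc (suc n))) ++ φ i (fib (suc n))    ≡⟨ sym (φ-++ i (fib (suc (suc n))) (fib (suc n))) ⟩
  φ i (fib (suc (suc n)) ++ fib (suc n))          ∎
  where open ≡-Reasoning

proposition4 : ∀ (i : ℕ) → ∃ λ (f : InfWord) → ∃ λ (fi : InfWord) →
    IsLimit fib f × IsLimit (fibI (i + 2)) fi × IsφImage i f fi
proposition4 i =
    Limit.lim fib-growing
  , Limit.lim (φ-growing i fib-growing)
  , IsLimit-unshift {fib} (Limit.isLimit fib-growing)
  , IsLimit-cong (λ n → sym (fibI-φ i n)) (Limit.isLimit (φ-growing i fib-growing))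
  , φ-limit i fib-growing
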